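{- Let $G$ be a graph and let $X\subseteq V(G)$ be non-empty. The following are equivalent: (1) $X$ is an immune set of $G$ with respect to the zero forcing rule; (2) $|\Sigma_1(X,e)|\geq 1$ for all edges $e\in E(G)$ with $e\setminus X\neq\emptyset$ and $e\cap X\neq\emptyset$; (3) $|\Sigma_2(X,e)|\geq 2$ for all edges $e\in E(G)$ with $e\setminus X\neq\emptyset$ and $e\cap X\neq\emptyset$.
   Context: Zero forcing rule on a graph $G$: vertices are black or white; at each step a black vertex with exactly one white neighbour forces this neighbour to become black; iterating until no change is possible from an initial black set $B$ gives a final black set $\mathcal{R}^\ast(B)$ independent of the order of steps. A non-empty $X\subseteq V(G)$ is an immune set if $\mathcal{R}^\ast(V(G)\setminus X)=V(G)\setminus X$. For $B\subseteq V(G)$ let $N(B)=\{A\in E(G): B\subseteq A\}$. For $X\subseteq V(G)$ and an edge $A$, define $\Sigma_1(X,A)=\{A'\in N(A\setminus X): (A'\cap X)\setminus A\neq\emptyset\}$ and $\Sigma_2(X,A)=\{A'\in N(A\setminus X): A'\cap X\neq\emptyset\}$ (edges are regarded as 2-element vertex sets). -}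

module Defs where

open import Data.Nat using (ℕ)
open import Data.Fin using (Fin)
open import Data.Fin.Subset using (Subset; _∈_; _⊆_; _∩_; _∪_; _─_; ⁅_⁆; ∁; Nonempty)
open import Data.Product using (Σ; ∃; ∃₂; _×_)
open import Relation.Binary.PropositionalEquality using (_≡_; _≢_)
open import Relation.Nullary using (¬_)
open import Relation.Binary.Definitions using (Decidable)

record Graph (n : ℕ) : Set₁ where
  field
    Adj    : Fin n → Fin n → Set
    sym    : ∀ {u v} → Adj u v → Adj v u
    irrefl : ∀ {u} → ¬ Adj u u
    adj?   : Decidable Adj
open Graph public

module _ {n : ℕ} (G : Graph n) where

  IsEdge : Subset n → Set
  IsEdge A = ∃₂ λ u v → Adj G u v × A ≡ ⁅ u ⁆ ∪ ⁅ v ⁆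

  InN : Subset n → Subset n → Set
  InN B A = IsEdge A × B ⊆ A

  -- R*(B): final black set of the zero forcing rule started from B
  -- (least set containing B closed under forcing: a black vertex u all of
  -- whose neighbours except v are black forces its neighbour v).
  data ZF (B : Subset n) : Fin n → Set where
    black : ∀ {v} → v ∈ B → ZF B v
    force : ∀ {u v} → ZF B u → Adj G u v →
            (∀ w → Adj G u w → w ≢ v → ZF B w) → ZF B v

  Immune : Subset n → Set
  Immune X = Nonempty X
           × (∀ v → ZF (∁ X) v → v ∈ ∁ X)
           × (∀ v → v ∈ ∁ X → ZF (∁ X) v)

  Σ₁ : Subset n → Subset n → Subset n → Set
  Σ₁ X A A' = InN (A ─ X) A' × Nonempty ((A' ∩ X) ─ A)

  Σ₂ : Subset n → Subset n → Subset n → Set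
  Σ₂ X A A' = InN (A ─ X) A' × Nonempty (A' ∩ X)

  Cond₂ : Subset n → Set
  Cond₂ X = ∀ e → IsEdge e → Nonempty (e ─ X) → Nonempty (e ∩ X) →
            ∃ λ A' → Σ₁ X e A'

  Cond₃ : Subset n → Set
  Cond₃ X = ∀ e → IsEdge e → Nonempty (e ─ X) → Nonempty (e ∩ X) →
            ∃₂ λ A' A'' → Σ₂ X e A' × Σ₂ X e A'' × A' ≢ A''

{-# OPTIONS --safe #-}
-- All three conditions are local reformulations of one property: no vertex u
-- outside X has exactly one neighbour in X. Starting from V(G) \ X, a forcing
-- move is precisely a vertex u ∉ X with a unique neighbour v ∈ X, so X is immune
-- iff no such move exists. For a mixed edge e = {u , v} (u ∉ X, v ∈ X) the
-- edges of N(e \ X) = N({u}) meeting X are the edges {u , w} with w ∈ X: one of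
-- them avoids v (condition 2) iff there are two of them (condition 3) iff v is
-- not the only neighbour of u in X.
module Submission where

open import Defs
open import Data.Nat using (ℕ)
open import Data.Fin using (Fin; _≟_)
open import Data.Fin.Subset
  using (Subset; Nonempty; _∈_; _∉_; _⊆_; _∩_; _∪_; _─_; ⁅_⁆; ∁; outside)
open import Data.Fin.Subset.Properties
  using (_∈?_; x∈⁅x⁆; x∈⁅y⁆⇒x≡y; x∈∁p⇒x∉p; x∉p⇒x∈∁p; x∈p∩q⁺; x∈p∩q⁻;
         x∈p∪q⁻; x∈p∪q⁺; x∈p∧x∉q⇒x∈p─q; p─q⊆p; ∪-comm)
import Data.Fin.Properties as Fin
open import Data.Vec using (_∷_; here; there)
open import Data.Product using (∃; ∃₂; _×_; _,_; proj₂)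
open import Data.Sum using (_⊎_; inj₁; inj₂)
open import Data.Empty using (⊥-elim)
open import Relation.Nullary using (Dec; yes; no)
open import Relation.Nullary.Decidable using (_×-dec_; ¬?)
open import Relation.Binary.PropositionalEquality using (_≡_; _≢_; refl; subst)
  renaming (sym to ≡-sym; trans to ≡-trans)
open import Function.Bundles using (_⇔_; mk⇔)
import Function.Properties.Equivalence as ⇔

x∈p─q⇒x∉q : ∀ {n} (p q : Subset n) {x} → x ∈ p ─ q → x ∉ q
x∈p─q⇒x∉q (_ ∷ p) (outside ∷ q) here      ()
x∈p─q⇒x∉q (_ ∷ p) (_ ∷ q)       (there m) (there x∈q) = x∈p─q⇒x∉q p q m x∈q

pair : ∀ {n} → Fin n → Fin n → Subset n
pair a b = ⁅ a ⁆ ∪ ⁅ b ⁆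

∈-pairˡ : ∀ {n} (x y : Fin n) → x ∈ pair x y
∈-pairˡ x y = x∈p∪q⁺ (inj₁ (x∈⁅x⁆ x))

∈-pairʳ : ∀ {n} (x y : Fin n) → y ∈ pair x y
∈-pairʳ x y = x∈p∪q⁺ (inj₂ (x∈⁅x⁆ y))

∈-pair⁻ : ∀ {n} {x y z : Fin n} → z ∈ pair x y → z ≡ x ⊎ z ≡ y
∈-pair⁻ {x = x} {y} z∈ with x∈p∪q⁻ ⁅ x ⁆ ⁅ y ⁆ z∈
... | inj₁ z∈⁅x⁆ = inj₁ (x∈⁅y⁆⇒x≡y x z∈⁅x⁆)
... | inj₂ z∈⁅y⁆ = inj₂ (x∈⁅y⁆⇒x≡y y z∈⁅y⁆)

module _ {n : ℕ} (G : Graph n) (X : Subset n) where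

  NoForcingMove : Set
  NoForcingMove = ∀ u v → u ∉ X → v ∈ X → Adj G u v →
                  ∃ λ w → Adj G u w × w ∈ X × w ≢ v

  edge-through : ∀ {A u} → IsEdge G A → u ∈ A → ∃ λ w → Adj G u w × A ≡ pair u w
  edge-through (a , b , a~b , refl) u∈A with ∈-pair⁻ u∈A
  ... | inj₁ refl = b , a~b , refl
  ... | inj₂ refl = a , sym G a~b , ∪-comm ⁅ a ⁆ ⁅ b ⁆

  edge-through-outside : ∀ {A u z} → u ∉ X → IsEdge G A → u ∈ A → z ∈ A ∩ X →
                         Adj G u z × A ≡ pair u z
  edge-through-outside u∉X A-edge u∈A z∈A∩X with x∈p∩q⁻ _ X z∈A∩X
  ... | z∈A , z∈X with edge-through A-edge u∈A
  ... | w , u~w , refl with ∈-pair⁻ z∈A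
  ... | inj₁ refl = ⊥-elim (u∉X z∈X)
  ... | inj₂ refl = u~w , refl

  mixed-edge : ∀ {e} → IsEdge G e → Nonempty (e ─ X) → Nonempty (e ∩ X) →
               ∃₂ λ u v → u ∉ X × v ∈ X × Adj G u v × e ≡ pair u v
  mixed-edge e-edge (u , u∈e─X) (v , v∈e∩X)
    with edge-through-outside (x∈p─q⇒x∉q _ X u∈e─X) e-edge (p─q⊆p _ X u∈e─X) v∈e∩X
  ... | u~v , e≡uv = u , v , x∈p─q⇒x∉q _ X u∈e─X , x∈p∩q⁻ _ X v∈e∩X .proj₂ , u~v , e≡uv

  module _ {u v : Fin n} (u∉X : u ∉ X) (v∈X : v ∈ X) where

    u∈uv─X : u ∈ pair u v ─ X
    u∈uv─X = x∈p∧x∉q⇒x∈p─q (∈-pairˡ u v) u∉X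

    v∈uv∩X : v ∈ pair u v ∩ X
    v∈uv∩X = x∈p∩q⁺ (∈-pairʳ u v , v∈X)

    uv─X⊆uw : ∀ w → pair u v ─ X ⊆ pair u w
    uv─X⊆uw w z∈ with ∈-pair⁻ (p─q⊆p _ X z∈)
    ... | inj₁ refl = ∈-pairˡ u w
    ... | inj₂ refl = ⊥-elim (x∈p─q⇒x∉q _ X z∈ v∈X)

    other∉pair : ∀ {w} → w ∈ X → w ≢ v → w ∉ pair u v
    other∉pair w∈X w≢v w∈uv with ∈-pair⁻ w∈uv
    ... | inj₁ refl = u∉X w∈X
    ... | inj₂ w≡v  = w≢v w≡v

    neighbour-in-N : ∀ {w} → Adj G u w → InN G (pair u v ─ X) (pair u w)
    neighbour-in-N {w} u~w = (u , w , u~w , refl) , uv─X⊆uw w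

    in-N-meeting-X : ∀ {A z} → InN G (pair u v ─ X) A → z ∈ A ∩ X →
                     Adj G u z × A ≡ pair u z
    in-N-meeting-X (A-edge , ⊆A) = edge-through-outside u∉X A-edge (⊆A u∈uv─X)

  immune⇔noForcingMove : Nonempty X → Immune G X ⇔ NoForcingMove
  immune⇔noForcingMove X≢∅ = mk⇔ immune⇒ ⇒immune
    where
    otherNeighbourIn? : ∀ u v → Dec (∃ λ w → Adj G u w × w ∈ X × w ≢ v)
    otherNeighbourIn? u v = Fin.any? λ w → adj? G u w ×-dec (w ∈? X) ×-dec ¬? (w ≟ v)

    immune⇒ : Immune G X → NoForcingMove
    immune⇒ (_ , closed , _) u v u∉X v∈X u~v with otherNeighbourIn? u v
    ... | yes w = w
    ... | no ∄w = ⊥-elim (x∈∁p⇒x∉p (closed v u-forces-v) v∈X)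
      where
      u-forces-v : ZF G (∁ X) v
      u-forces-v = force (black (x∉p⇒x∈∁p u∉X)) u~v λ w u~w w≢v →
        black (x∉p⇒x∈∁p λ w∈X → ∄w (w , u~w , w∈X , w≢v))

    ⇒immune : NoForcingMove → Immune G X
    ⇒immune noMove = X≢∅ , closed , λ _ → black
      where
      closed : ∀ v → ZF G (∁ X) v → v ∈ ∁ X
      closed v (black v∈∁X) = v∈∁X
      closed v (force {u} zu u~v others) with v ∈? X
      ... | no v∉X = x∉p⇒x∈∁p v∉X
      ... | yes v∈X with noMove u v (x∈∁p⇒x∉p (closed u zu)) v∈X u~v
      ... | w , u~w , w∈X , w≢v = ⊥-elim (x∈∁p⇒x∉p (closed w (others w u~w w≢v)) w∈X)

  cond₂⇔noForcingMove : Cond₂ G X ⇔ NoForcingMove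
  cond₂⇔noForcingMove = mk⇔ cond₂⇒ ⇒cond₂
    where
    cond₂⇒ : Cond₂ G X → NoForcingMove
    cond₂⇒ c u v u∉X v∈X u~v
      with c (pair u v) (u , v , u~v , refl) (u , u∈uv─X u∉X v∈X) (v , v∈uv∩X u∉X v∈X)
    ... | A , A∈N , (w , w∈A∩X─e) with p─q⊆p _ _ w∈A∩X─e
    ... | w∈A∩X with in-N-meeting-X u∉X v∈X A∈N w∈A∩X
    ... | u~w , _ = w , u~w , x∈p∩q⁻ A X w∈A∩X .proj₂ ,
                    λ { refl → x∈p─q⇒x∉q _ _ w∈A∩X─e (∈-pairʳ u v) }

    ⇒cond₂ : NoForcingMove → Cond₂ G X
    ⇒cond₂ noMove e e-edge e─X≢∅ e∩X≢∅ with mixed-edge e-edge e─X≢∅ e∩X≢∅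
    ... | u , v , u∉X , v∈X , u~v , refl with noMove u v u∉X v∈X u~v
    ... | w , u~w , w∈X , w≢v =
      pair u w , neighbour-in-N u∉X v∈X u~w ,
      (w , x∈p∧x∉q⇒x∈p─q (x∈p∩q⁺ (∈-pairʳ u w , w∈X)) (other∉pair u∉X v∈X w∈X w≢v))

  cond₃⇔noForcingMove : Cond₃ G X ⇔ NoForcingMove
  cond₃⇔noForcingMove = mk⇔ cond₃⇒ ⇒cond₃
    where
    cond₃⇒ : Cond₃ G X → NoForcingMove
    cond₃⇒ c u v u∉X v∈X u~v
      with c (pair u v) (u , v , u~v , refl) (u , u∈uv─X u∉X v∈X) (v , v∈uv∩X u∉X v∈X)
    ... | A , B , (A∈N , (w , w∈A∩X)) , (B∈N , (w′ , w′∈B∩X)) , A≢B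
      with in-N-meeting-X u∉X v∈X A∈N w∈A∩X | in-N-meeting-X u∉X v∈X B∈N w′∈B∩X
    ... | u~w , A≡uw | u~w′ , B≡uw′ with w ≟ v | w′ ≟ v
    ... | no w≢v   | _         = w , u~w , x∈p∩q⁻ A X w∈A∩X .proj₂ , w≢v
    ... | yes _    | no w′≢v   = w′ , u~w′ , x∈p∩q⁻ B X w′∈B∩X .proj₂ , w′≢v
    ... | yes refl | yes refl  = ⊥-elim (A≢B (≡-trans A≡uw (≡-sym B≡uw′)))

    ⇒cond₃ : NoForcingMove → Cond₃ G X
    ⇒cond₃ noMove e e-edge e─X≢∅ e∩X≢∅ with mixed-edge e-edge e─X≢∅ e∩X≢∅
    ... | u , v , u∉X , v∈X , u~v , refl with noMove u v u∉X v∈X u~v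
    ... | w , u~w , w∈X , w≢v =
      pair u v , pair u w ,
      (neighbour-in-N u∉X v∈X u~v , (v , v∈uv∩X u∉X v∈X)) ,
      (neighbour-in-N u∉X v∈X u~w , (w , x∈p∩q⁺ (∈-pairʳ u w , w∈X))) ,
      λ uv≡uw → other∉pair u∉X v∈X w∈X w≢v (subst (w ∈_) (≡-sym uv≡uw) (∈-pairʳ u w))

proposition5 : (n : ℕ) (G : Graph n) (X : Subset n) → Nonempty X →
    (Immune G X ⇔ Cond₂ G X) × (Immune G X ⇔ Cond₃ G X) × (Cond₂ G X ⇔ Cond₃ G X)
proposition5 n G X X≢∅ =
  ⇔.trans immune⇔ (⇔.sym cond₂⇔) ,
  ⇔.trans immune⇔ (⇔.sym cond₃⇔) ,
  ⇔.trans cond₂⇔ (⇔.sym cond₃⇔)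
  where
  immune⇔ : Immune G X ⇔ NoForcingMove G X
  immune⇔ = immune⇔noForcingMove G X X≢∅

  cond₂⇔ : Cond₂ G X ⇔ NoForcingMove G X
  cond₂⇔ = cond₂⇔noForcingMove G X

  cond₃⇔ : Cond₃ G X ⇔ NoForcingMove G X
  cond₃⇔ = cond₃⇔noForcingMove G X
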